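{- There exists an fgv $\vec G$ which is weakly constant but not rectifying.
   Context: Untyped $\lambda$-calculus; $=$ denotes $\beta$-conversion. For $\vec G=(G_0,\dots,G_n)$, $M\vec G=MG_0\cdots G_n$; $F^k(z)=F(F(\cdots F(z)\cdots))$ with $k$ copies of $F$. $M=^\infty N$ means $M$ and $N$ have the same Böhm tree. $Y$ is an fpc if $Yx=x(Yx)$ for $x$ not free in $Y$, a wfpc if $Yx=^\infty x(Yx)$; $\mathsf{FPC},\mathsf{WFPC}$ are the sets of these. $\vec G$ is an fgv if $Y\in\mathsf{FPC}\Rightarrow Y\vec G\in\mathsf{FPC}$; it is rectifying if $Y\in\mathsf{WFPC}\Rightarrow Y\vec G\in\mathsf{FPC}$. Write $z\notin^\infty M$ if some $N=^\infty M$ has $z$ not free in $N$. $\vec G$ is weakly constant if, for a variable $z$ not free in $\vec G$, there is $k\ge0$ with $z\notin^\infty G_0^k(z)G_1\cdots G_n$. -}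

module Defs where

open import Data.Nat using (ℕ; zero; suc; pred; _<ᵇ_; _≡ᵇ_)
open import Data.Bool using (if_then_else_)
open import Data.List using (List; []; _∷_)
open import Data.Vec using (Vec; lookup)
open import Data.Fin using (Fin)
open import Data.Product using (Σ; ∃; ∃-syntax; _×_)
open import Data.Sum using (_⊎_)
open import Relation.Nullary using (¬_)
open import Relation.Binary.PropositionalEquality using (_≡_)
open import Relation.Binary.Construct.Closure.Equivalence using (EqClosure)

-- Untyped λ-terms, de Bruijn indices (free variables = indices that
-- escape all binders; variable x free at top level is  var x).

data Term : Set where
  var : ℕ → Term
  app : Term → Term → Term
  lam : Term → Term

shift : ℕ → Term → Term
shift c (var x)   = if x <ᵇ c then var x else var (suc x)
shift c (app M N) = app (shift c M) (shift c N)
shift c (lam M)   = lam (shift (suc c) M)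

sub : ℕ → Term → Term → Term
sub j N (var x)   = if x <ᵇ j then var x else (if x ≡ᵇ j then N else var (pred x))
sub j N (app M P) = app (sub j N M) (sub j N P)
sub j N (lam M)   = lam (sub (suc j) (shift 0 N) M)

data _→β_ : Term → Term → Set where
  beta : ∀ {M N} → app (lam M) N →β sub 0 N M
  appL : ∀ {M M' N} → M →β M' → app M N →β app M' N
  appR : ∀ {M N N'} → N →β N' → app M N →β app M N'
  ξ    : ∀ {M M'} → M →β M' → lam M →β lam M'

_=β_ : Term → Term → Set
_=β_ = EqClosure _→β_

data FreeIn : ℕ → Term → Set where
  fv-var : ∀ {x} → FreeIn x (var x)
  fv-appL : ∀ {x M N} → FreeIn x M → FreeIn x (app M N)
  fv-appR : ∀ {x M N} → FreeIn x N → FreeIn x (app M N)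
  fv-lam : ∀ {x M} → FreeIn (suc x) M → FreeIn x (lam M)

apps : Term → List Term → Term
apps M []       = M
apps M (N ∷ Ns) = apps (app M N) Ns

appsV : ∀ {m} → Term → Vec Term m → Term
appsV M Data.Vec.[] = M
appsV M (N Data.Vec.∷ Ns) = appsV (app M N) Ns

lams : ℕ → Term → Term
lams zero M    = M
lams (suc n) M = lam (lams n M)

iter : Term → ℕ → Term → Term
iter F zero z    = z
iter F (suc k) z = app F (iter F k z)

HasHNF : Term → Set
HasHNF M = ∃[ n ] ∃[ i ] ∃[ m ] Σ (Vec Term m) (λ Ps → M =β lams n (appsV (var i) Ps))

Unsolvable : Term → Set
Unsolvable M = ¬ HasHNF M

-- Böhm trees of M and N agree up to depth k
data BTEq : ℕ → Term → Term → Set where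
  bt-zero : ∀ {M N} → BTEq zero M N
  bt-uns  : ∀ {k M N} → Unsolvable M → Unsolvable N → BTEq (suc k) M N
  bt-hnf  : ∀ {k M N} n i m (Ps Qs : Vec Term m) →
            M =β lams n (appsV (var i) Ps) →
            N =β lams n (appsV (var i) Qs) →
            (∀ (j : Fin m) → BTEq k (lookup Ps j) (lookup Qs j)) →
            BTEq (suc k) M N

_=∞_ : Term → Term → Set
M =∞ N = ∀ k → BTEq k M N

NotFreeInf : ℕ → Term → Set
NotFreeInf z M = ∃[ N ] (N =∞ M × ¬ FreeIn z N)

FPC : Term → Set
FPC Y = ∀ x → ¬ FreeIn x Y → app Y (var x) =β app (var x) (app Y (var x))

WFPC : Term → Set
WFPC Y = ∀ x → ¬ FreeIn x Y → app Y (var x) =∞ app (var x) (app Y (var x))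

-- a vector G⃗ = (G₀, G₁, …, Gₙ) is given as G₀ together with the list G₁ … Gₙ
_·G_ : Term → Term × List Term → Term
Y ·G (G₀ Data.Product., Gs) = apps (app Y G₀) Gs

FreeInVec : ℕ → Term × List Term → Set
FreeInVec z (G₀ Data.Product., Gs) = FreeIn z G₀ ⊎ Data.List.Relation.Unary.Any.Any (FreeIn z) Gs
  where import Data.List.Relation.Unary.Any

FGV : Term × List Term → Set
FGV G = ∀ Y → FPC Y → FPC (Y ·G G)

Rectifying : Term × List Term → Set
Rectifying G = ∀ Y → WFPC Y → FPC (Y ·G G)

WeaklyConstant : Term × List Term → Set
WeaklyConstant (G₀ Data.Product., Gs) =
  ∀ z → ¬ FreeInVec z (G₀ Data.Product., Gs) →
  ∃[ k ] NotFreeInf z (apps (iter G₀ k (var z)) Gs)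

-- Take G = (T, UU) with the thrush T = λab.ba, ⟨w⟩ = λy.y w and UU w x ↠ x (UU ⟨w⟩ x).
-- If Y is an fpc then y = Y T satisfies y = T y = ⟨y⟩, so Y T UU = ⟨y⟩ UU = UU y and
-- UU y x = x (UU ⟨y⟩ x) = x (UU y x).  The Böhm tree of UU w is λx.x(x(x⋯)) whatever w is,
-- so T z UU = UU z has the Böhm tree of the closed term UU I, and UU I is a wfpc.
-- But UU I T UU = UU P with P = UU ⟨I⟩ T, and the fixed point equation for it would give
-- ⟨P⟩ = P, hence (unfolding P once more) ⟨I⟩ = ⟨⟨I⟩⟩ and I = ⟨I⟩, two distinct normal forms.
-- The key fact is that UU A X = UU B X forces A = B when X is a variable or T: every reduct
-- of UU A X still records A up to conversion, which with Church–Rosser gives injectivity.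
module Submission where

open import Defs
open import Data.Bool using (Bool; true; false; T; _∧_)
open import Data.Bool.Properties using (T-∧)
open import Data.Fin using (zero)
open import Data.List using (List; []; _∷_)
open import Data.Nat using (ℕ; zero; suc; _<_; _≤_; z≤n; s≤s; _<ᵇ_; _≡ᵇ_; _⊔_; _<?_)
open import Data.Nat.Properties
open import Data.Product using (Σ; ∃-syntax; _×_; _,_; proj₁; proj₂)
open import Data.Unit using (tt)
open import Data.Vec using ([]; _∷_)
open import Function.Base using (_∘_)
open import Function.Bundles using (Equivalence)
open import Relation.Binary.Construct.Closure.ReflexiveTransitive as Star using (Star; ε; _◅_; _◅◅_)
open import Relation.Binary.Construct.Closure.Symmetric using (fwd; bwd)
import Relation.Binary.Construct.Closure.Equivalence as EqClosure
open import Relation.Binary.Definitions using (tri<; tri≈; tri>)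
open import Relation.Binary.PropositionalEquality
import Relation.Binary.Reasoning.Setoid
open import Relation.Nullary using (¬_; yes; no; contradiction)

<ᵇ-true : ∀ {m n} → m < n → (m <ᵇ n) ≡ true
<ᵇ-true {zero} (s≤s _) = refl
<ᵇ-true {suc m} (s≤s m<n) = <ᵇ-true m<n

<ᵇ-false : ∀ {m n} → n ≤ m → (m <ᵇ n) ≡ false
<ᵇ-false z≤n = refl
<ᵇ-false (s≤s n≤m) = <ᵇ-false n≤m

≡ᵇ-refl : ∀ n → (n ≡ᵇ n) ≡ true
≡ᵇ-refl zero = refl
≡ᵇ-refl (suc n) = ≡ᵇ-refl n

1+m≡ᵇn-false : ∀ {m n} → n ≤ m → (suc m ≡ᵇ n) ≡ false
1+m≡ᵇn-false z≤n = refl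
1+m≡ᵇn-false (s≤s n≤m) = 1+m≡ᵇn-false n≤m

shift-var-< : ∀ {c x} → x < c → shift c (var x) ≡ var x
shift-var-< x<c rewrite <ᵇ-true x<c = refl

shift-var-≥ : ∀ {c x} → c ≤ x → shift c (var x) ≡ var (suc x)
shift-var-≥ c≤x rewrite <ᵇ-false c≤x = refl

sub-var-< : ∀ {j x} N → x < j → sub j N (var x) ≡ var x
sub-var-< N x<j rewrite <ᵇ-true x<j = refl

sub-var-≡ : ∀ j N → sub j N (var j) ≡ N
sub-var-≡ j N rewrite <ᵇ-false (≤-refl {j}) | ≡ᵇ-refl j = refl

sub-var-> : ∀ {j x} N → j ≤ x → sub j N (var (suc x)) ≡ var x
sub-var-> N j≤x rewrite <ᵇ-false (m≤n⇒m≤1+n j≤x) | 1+m≡ᵇn-false j≤x = refl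

shift-shift : ∀ {c d} M → c ≤ d → shift (suc d) (shift c M) ≡ shift c (shift d M)
shift-shift {c} {d} (var x) c≤d with x <? c | x <? d
... | yes x<c | _ rewrite shift-var-< x<c | shift-var-< (≤-trans x<c c≤d)
                        | shift-var-< (m≤n⇒m≤1+n (≤-trans x<c c≤d)) | shift-var-< x<c = refl
... | no x≮c | yes x<d rewrite shift-var-≥ (≮⇒≥ x≮c) | shift-var-< x<d
                             | shift-var-< (s≤s x<d) | shift-var-≥ (≮⇒≥ x≮c) = refl
... | no x≮c | no x≮d rewrite shift-var-≥ (≮⇒≥ x≮c) | shift-var-≥ (≮⇒≥ x≮d)
                            | shift-var-≥ (s≤s (≮⇒≥ x≮d)) | shift-var-≥ (m≤n⇒m≤1+n (≮⇒≥ x≮c)) = refl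
shift-shift (app M N) c≤d = cong₂ app (shift-shift M c≤d) (shift-shift N c≤d)
shift-shift (lam M) c≤d = cong lam (shift-shift M (s≤s c≤d))

sub-shift : ∀ {j} N M → sub j N (shift j M) ≡ M
sub-shift {j} N (var x) with x <? j
... | yes x<j rewrite shift-var-< x<j = sub-var-< N x<j
... | no x≮j rewrite shift-var-≥ (≮⇒≥ x≮j) = sub-var-> N (≮⇒≥ x≮j)
sub-shift N (app M P) = cong₂ app (sub-shift N M) (sub-shift N P)
sub-shift N (lam M) = cong lam (sub-shift (shift 0 N) M)

shift-sub-≤ : ∀ {c j} N M → c ≤ j → shift c (sub j N M) ≡ sub (suc j) (shift c N) (shift c M)
shift-sub-≤ {c} {j} N (var x) c≤j with <-cmp x j
... | tri< x<j _ _ with x <? c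
...   | yes x<c rewrite sub-var-< N x<j | shift-var-< x<c
                      | sub-var-< (shift c N) (m≤n⇒m≤1+n x<j) = refl
...   | no x≮c rewrite sub-var-< N x<j | shift-var-≥ (≮⇒≥ x≮c)
                     | sub-var-< (shift c N) (s≤s x<j) = refl
shift-sub-≤ {c} {j} N (var x) c≤j | tri≈ _ refl _
  rewrite sub-var-≡ j N | shift-var-≥ c≤j | sub-var-≡ (suc j) (shift c N) = refl
shift-sub-≤ {c} {j} N (var (suc x)) c≤j | tri> _ _ (s≤s j≤x)
  rewrite sub-var-> N j≤x | shift-var-≥ (≤-trans c≤j j≤x) | shift-var-≥ (≤-trans c≤j (m≤n⇒m≤1+n j≤x))
        | sub-var-> (shift c N) (s≤s j≤x) = refl
shift-sub-≤ N (app M P) c≤j = cong₂ app (shift-sub-≤ N M c≤j) (shift-sub-≤ N P c≤j)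
shift-sub-≤ {c} {j} N (lam M) c≤j = cong lam (begin
  shift (suc c) (sub (suc j) (shift 0 N) M)                    ≡⟨ shift-sub-≤ (shift 0 N) M (s≤s c≤j) ⟩
  sub (suc (suc j)) (shift (suc c) (shift 0 N)) (shift (suc c) M) ≡⟨ cong (λ N′ → sub (suc (suc j)) N′ (shift (suc c) M)) (shift-shift N z≤n) ⟩
  sub (suc (suc j)) (shift 0 (shift c N)) (shift (suc c) M)       ∎)
  where open ≡-Reasoning

shift-sub-≥ : ∀ {c j} N M → j ≤ c → shift c (sub j N M) ≡ sub j (shift c N) (shift (suc c) M)
shift-sub-≥ {c} {j} N (var x) j≤c with <-cmp x j
... | tri< x<j _ _ rewrite sub-var-< N x<j | shift-var-< (≤-trans x<j j≤c)
                         | shift-var-< (m≤n⇒m≤1+n (≤-trans x<j j≤c)) | sub-var-< (shift c N) x<j = refl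
... | tri≈ _ refl _ rewrite sub-var-≡ j N | shift-var-< (s≤s j≤c) | sub-var-≡ j (shift c N) = refl
shift-sub-≥ {c} {j} N (var (suc x)) j≤c | tri> _ _ (s≤s j≤x) with x <? c
... | yes x<c rewrite sub-var-> N j≤x | shift-var-< x<c | shift-var-< (s≤s x<c)
                    | sub-var-> (shift c N) j≤x = refl
... | no x≮c rewrite sub-var-> N j≤x | shift-var-≥ (≮⇒≥ x≮c) | shift-var-≥ (s≤s (≮⇒≥ x≮c))
                   | sub-var-> (shift c N) (m≤n⇒m≤1+n j≤x) = refl
shift-sub-≥ N (app M P) j≤c = cong₂ app (shift-sub-≥ N M j≤c) (shift-sub-≥ N P j≤c)
shift-sub-≥ {c} {j} N (lam M) j≤c = cong lam (begin
  shift (suc c) (sub (suc j) (shift 0 N) M)                     ≡⟨ shift-sub-≥ (shift 0 N) M (s≤s j≤c) ⟩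
  sub (suc j) (shift (suc c) (shift 0 N)) (shift (suc (suc c)) M) ≡⟨ cong (λ N′ → sub (suc j) N′ (shift (suc (suc c)) M)) (shift-shift N z≤n) ⟩
  sub (suc j) (shift 0 (shift c N)) (shift (suc (suc c)) M)       ∎)
  where open ≡-Reasoning

sub-sub : ∀ {i j} N P M → i ≤ j → sub j N (sub i P M) ≡ sub i (sub j N P) (sub (suc j) (shift i N) M)
sub-sub {i} {j} N P (var x) i≤j with <-cmp x i
... | tri< x<i _ _ rewrite sub-var-< P x<i | sub-var-< N (≤-trans x<i i≤j)
                         | sub-var-< (shift i N) (m≤n⇒m≤1+n (≤-trans x<i i≤j)) | sub-var-< (sub j N P) x<i = refl
... | tri≈ _ refl _ rewrite sub-var-≡ i P | sub-var-< (shift i N) (s≤s i≤j) | sub-var-≡ i (sub j N P) = refl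
sub-sub {i} {j} N P (var (suc x)) i≤j | tri> _ _ (s≤s i≤x) with <-cmp x j
... | tri< x<j _ _ rewrite sub-var-> P i≤x | sub-var-< N x<j | sub-var-< (shift i N) (s≤s x<j)
                         | sub-var-> (sub j N P) i≤x = refl
... | tri≈ _ refl _ rewrite sub-var-> P i≤x | sub-var-≡ j N | sub-var-≡ (suc j) (shift i N) =
  sym (sub-shift (sub j N P) N)
sub-sub {i} {j} N P (var (suc (suc x))) i≤j | tri> _ _ (s≤s i≤x) | tri> _ _ (s≤s j≤x)
  rewrite sub-var-> P i≤x | sub-var-> N j≤x | sub-var-> (shift i N) (s≤s j≤x)
        | sub-var-> (sub j N P) (≤-trans i≤j j≤x) = refl
sub-sub N P (app M Q) i≤j = cong₂ app (sub-sub N P M i≤j) (sub-sub N P Q i≤j)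
sub-sub {i} {j} N P (lam M) i≤j = cong lam (begin
  sub (suc j) (shift 0 N) (sub (suc i) (shift 0 P) M)
    ≡⟨ sub-sub (shift 0 N) (shift 0 P) M (s≤s i≤j) ⟩
  sub (suc i) (sub (suc j) (shift 0 N) (shift 0 P)) (sub (suc (suc j)) (shift (suc i) (shift 0 N)) M)
    ≡⟨ cong₂ (λ P′ N′ → sub (suc i) P′ (sub (suc (suc j)) N′ M)) (sym (shift-sub-≤ N P z≤n)) (shift-shift N z≤n) ⟩
  sub (suc i) (shift 0 (sub j N P)) (sub (suc (suc j)) (shift 0 (shift i N)) M)
    ∎)
  where open ≡-Reasoning

_→*_ : Term → Term → Set
_→*_ = Star _→β_

→β-shift : ∀ {c M N} → M →β N → shift c M →β shift c N
→β-shift {c} (beta {M} {N}) = subst (app (lam (shift (suc c) M)) (shift c N) →β_) (sym (shift-sub-≥ N M z≤n)) beta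
→β-shift (appL s) = appL (→β-shift s)
→β-shift (appR s) = appR (→β-shift s)
→β-shift (ξ s) = ξ (→β-shift s)

→β-sub : ∀ {j P M N} → M →β N → sub j P M →β sub j P N
→β-sub {j} {P} (beta {M} {N}) = subst (app (lam (sub (suc j) (shift 0 P) M)) (sub j P N) →β_) (sym (sub-sub P N M z≤n)) beta
→β-sub (appL s) = appL (→β-sub s)
→β-sub (appR s) = appR (→β-sub s)
→β-sub (ξ s) = ξ (→β-sub s)

→*-appˡ : ∀ {M M′ N} → M →* M′ → app M N →* app M′ N
→*-appˡ {N = N} = Star.gmap (λ M → app M N) appL

→*-appʳ : ∀ {M N N′} → N →* N′ → app M N →* app M N′
→*-appʳ {M} = Star.gmap (app M) appR

→*-lam : ∀ {M M′} → M →* M′ → lam M →* lam M′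
→*-lam = Star.gmap lam ξ

→*⇒=β : ∀ {M N} → M →* N → M =β N
→*⇒=β = Star.map fwd

≡⇒=β : ∀ {M N} → M ≡ N → M =β N
≡⇒=β refl = ε

=β-sym : ∀ {M N} → M =β N → N =β M
=β-sym = EqClosure.symmetric _→β_

=β-appˡ : ∀ {M M′ N} → M =β M′ → app M N =β app M′ N
=β-appˡ {N = N} = EqClosure.gmap (λ M → app M N) appL

=β-appʳ : ∀ {M N N′} → N =β N′ → app M N =β app M N′
=β-appʳ {M} = EqClosure.gmap (app M) appR

=β-lam : ∀ {M M′} → M =β M′ → lam M =β lam M′
=β-lam = EqClosure.gmap lam ξ

=β-shift : ∀ {c M M′} → M =β M′ → shift c M =β shift c M′
=β-shift {c} = EqClosure.gmap (shift c) →β-shift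

=β-sub : ∀ {j P M M′} → M =β M′ → sub j P M =β sub j P M′
=β-sub {j} {P} = EqClosure.gmap (sub j P) →β-sub

=β-unshift : ∀ {M N} → shift 0 M =β shift 0 N → M =β N
=β-unshift {M} {N} = subst₂ _=β_ (sub-shift (var 0) M) (sub-shift (var 0) N) ∘ =β-sub

module =β-Reasoning = Relation.Binary.Reasoning.Setoid (EqClosure.setoid _→β_)

infix 4 _⇛_

data _⇛_ : Term → Term → Set where
  ⇛-var : ∀ {x} → var x ⇛ var x
  ⇛-app : ∀ {M M′ N N′} → M ⇛ M′ → N ⇛ N′ → app M N ⇛ app M′ N′
  ⇛-lam : ∀ {M M′} → M ⇛ M′ → lam M ⇛ lam M′
  ⇛-beta : ∀ {M M′ N N′} → M ⇛ M′ → N ⇛ N′ → app (lam M) N ⇛ sub 0 N′ M′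

⇛-refl : ∀ {M} → M ⇛ M
⇛-refl {var x} = ⇛-var
⇛-refl {app M N} = ⇛-app ⇛-refl ⇛-refl
⇛-refl {lam M} = ⇛-lam ⇛-refl

⇛-shift : ∀ {c M M′} → M ⇛ M′ → shift c M ⇛ shift c M′
⇛-shift ⇛-var = ⇛-refl
⇛-shift (⇛-app p q) = ⇛-app (⇛-shift p) (⇛-shift q)
⇛-shift (⇛-lam p) = ⇛-lam (⇛-shift p)
⇛-shift {c} (⇛-beta {M} {M′} {N} {N′} p q) =
  subst (app (lam (shift (suc c) M)) (shift c N) ⇛_) (sym (shift-sub-≥ N′ M′ z≤n)) (⇛-beta (⇛-shift p) (⇛-shift q))

⇛-sub : ∀ {j M M′ N N′} → M ⇛ M′ → N ⇛ N′ → sub j N M ⇛ sub j N′ M′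
⇛-sub {j} (⇛-var {x}) q with x <ᵇ j | x ≡ᵇ j
... | true | _ = ⇛-var
... | false | true = q
... | false | false = ⇛-var
⇛-sub (⇛-app p p′) q = ⇛-app (⇛-sub p q) (⇛-sub p′ q)
⇛-sub (⇛-lam p) q = ⇛-lam (⇛-sub p (⇛-shift q))
⇛-sub {j} {N = N} {N′} (⇛-beta {M} {M′} {P} {P′} p p′) q =
  subst (app (lam (sub (suc j) (shift 0 N) M)) (sub j N P) ⇛_) (sym (sub-sub N′ P′ M′ z≤n))
        (⇛-beta (⇛-sub p (⇛-shift q)) (⇛-sub p′ q))

complete-development : Term → Term
complete-development-app : Term → Term → Term
complete-development (var x) = var x
complete-development (lam M) = lam (complete-development M)
complete-development (app M N) = complete-development-app M N
complete-development-app (lam M) N = sub 0 (complete-development N) (complete-development M)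
complete-development-app (var x) N = app (var x) (complete-development N)
complete-development-app (app M₁ M₂) N = app (complete-development-app M₁ M₂) (complete-development N)

-- Takahashi's triangle property.
⇛-complete-development : ∀ {M N} → M ⇛ N → N ⇛ complete-development M
⇛-complete-development ⇛-var = ⇛-var
⇛-complete-development (⇛-lam p) = ⇛-lam (⇛-complete-development p)
⇛-complete-development (⇛-beta p q) = ⇛-sub (⇛-complete-development p) (⇛-complete-development q)
⇛-complete-development (⇛-app {var x} ⇛-var q) = ⇛-app ⇛-var (⇛-complete-development q)
⇛-complete-development (⇛-app {app M₁ M₂} p q) = ⇛-app (⇛-complete-development p) (⇛-complete-development q)
⇛-complete-development (⇛-app {lam M} (⇛-lam p) q) = ⇛-beta (⇛-complete-development p) (⇛-complete-development q)

→β⇒⇛ : ∀ {M N} → M →β N → M ⇛ N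
→β⇒⇛ beta = ⇛-beta ⇛-refl ⇛-refl
→β⇒⇛ (appL s) = ⇛-app (→β⇒⇛ s) ⇛-refl
→β⇒⇛ (appR s) = ⇛-app ⇛-refl (→β⇒⇛ s)
→β⇒⇛ (ξ s) = ⇛-lam (→β⇒⇛ s)

⇛⇒→* : ∀ {M N} → M ⇛ N → M →* N
⇛⇒→* ⇛-var = ε
⇛⇒→* (⇛-app p q) = →*-appˡ (⇛⇒→* p) ◅◅ →*-appʳ (⇛⇒→* q)
⇛⇒→* (⇛-lam p) = →*-lam (⇛⇒→* p)
⇛⇒→* (⇛-beta p q) = →*-appˡ (→*-lam (⇛⇒→* p)) ◅◅ →*-appʳ (⇛⇒→* q) ◅◅ beta ◅ ε

Joinable : (Term → Term → Set) → Term → Term → Set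
Joinable _↠_ M N = ∃[ Q ] (M ↠ Q × N ↠ Q)

⇛-strip : ∀ {M N P} → M ⇛ N → Star _⇛_ M P → ∃[ Q ] (Star _⇛_ N Q × P ⇛ Q)
⇛-strip p ε = _ , ε , p
⇛-strip p (q ◅ qs) with ⇛-strip (⇛-complete-development q) qs
... | Q , a , b = Q , ⇛-complete-development p ◅ a , b

⇛*-confluent : ∀ {M N P} → Star _⇛_ M N → Star _⇛_ M P → Joinable (Star _⇛_) N P
⇛*-confluent ε r = _ , r , ε
⇛*-confluent (p ◅ ps) r with ⇛-strip p r
... | Q , a , b with ⇛*-confluent ps a
...   | R , c , d = R , c , b ◅ d

→*-confluent : ∀ {M N P} → M →* N → M →* P → Joinable _→*_ N P
→*-confluent a b with ⇛*-confluent (Star.map →β⇒⇛ a) (Star.map →β⇒⇛ b)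
... | Q , c , d = Q , Star.concat (Star.map ⇛⇒→* c) , Star.concat (Star.map ⇛⇒→* d)

church-rosser : ∀ {M N} → M =β N → Joinable _→*_ M N
church-rosser ε = _ , ε , ε
church-rosser (fwd s ◅ r) with church-rosser r
... | Q , a , b = Q , s ◅ a , b
church-rosser (bwd s ◅ r) with church-rosser r
... | Q , a , b with →*-confluent (s ◅ ε) a
...   | R , c , d = R , c , b ◅◅ d

data Neutral : Term → Set
data Normal : Term → Set

data Neutral where
  var : ∀ {x} → Neutral (var x)
  app : ∀ {M N} → Neutral M → Normal N → Neutral (app M N)

data Normal where
  neutral : ∀ {M} → Neutral M → Normal M
  lam : ∀ {M} → Normal M → Normal (lam M)

neutral-irreducible : ∀ {M N} → Neutral M → ¬ (M →β N)
normal-irreducible : ∀ {M N} → Normal M → ¬ (M →β N)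
neutral-irreducible (app m n) (appL s) = neutral-irreducible m s
neutral-irreducible (app m n) (appR s) = normal-irreducible n s
normal-irreducible (neutral m) s = neutral-irreducible m s
normal-irreducible (lam m) (ξ s) = normal-irreducible m s

normal-→*-≡ : ∀ {M N} → Normal M → M →* N → M ≡ N
normal-→*-≡ m ε = refl
normal-→*-≡ m (s ◅ _) = contradiction s (normal-irreducible m)

normal-=β-≡ : ∀ {M N} → Normal M → Normal N → M =β N → M ≡ N
normal-=β-≡ m n e with church-rosser e
... | _ , a , b = trans (normal-→*-≡ m a) (sym (normal-→*-≡ n b))

scoped : ℕ → Term → Bool
scoped n (var x) = x <ᵇ n
scoped n (app M N) = scoped n M ∧ scoped n N
scoped n (lam M) = scoped (suc n) M

Scoped : ℕ → Term → Set
Scoped n M = T (scoped n M)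

Closed : Term → Set
Closed = Scoped 0

scoped-app : ∀ {n} M N → Scoped n (app M N) → Scoped n M × Scoped n N
scoped-app M N = Equivalence.to T-∧

scoped-free : ∀ {n x} M → Scoped n M → FreeIn x M → x < n
scoped-free {n} {x} (var x) t fv-var = <ᵇ⇒< x n t
scoped-free (app M N) t (fv-appL f) = scoped-free M (proj₁ (scoped-app M N t)) f
scoped-free (app M N) t (fv-appR f) = scoped-free N (proj₂ (scoped-app M N t)) f
scoped-free (lam M) t (fv-lam f) = ≤-pred (scoped-free M t f)

closed-not-free : ∀ {x} M → Closed M → ¬ FreeIn x M
closed-not-free M t f with () ← scoped-free M t f

scoped-mono : ∀ {m n} M → m ≤ n → Scoped m M → Scoped n M
scoped-mono {m} (var x) m≤n t = <⇒<ᵇ (≤-trans (<ᵇ⇒< x m t) m≤n)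
scoped-mono (app M N) m≤n t with (tM , tN) ← scoped-app M N t =
  Equivalence.from T-∧ (scoped-mono M m≤n tM , scoped-mono N m≤n tN)
scoped-mono (lam M) m≤n t = scoped-mono M (s≤s m≤n) t

sub-scoped : ∀ {n j} N M → Scoped n M → n ≤ j → sub j N M ≡ M
sub-scoped {n} N (var x) t n≤j = sub-var-< N (≤-trans (<ᵇ⇒< x n t) n≤j)
sub-scoped N (app M P) t n≤j with (tM , tP) ← scoped-app M P t =
  cong₂ app (sub-scoped N M tM n≤j) (sub-scoped N P tP n≤j)
sub-scoped N (lam M) t n≤j = cong lam (sub-scoped (shift 0 N) M t (s≤s n≤j))

fresh : Term → ℕ
fresh (var x) = suc x
fresh (app M N) = fresh M ⊔ fresh N
fresh (lam M) = fresh M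

scoped-fresh : ∀ M → Scoped (fresh M) M
scoped-fresh (var x) = <⇒<ᵇ (n<1+n x)
scoped-fresh (app M N) = Equivalence.from T-∧
  (scoped-mono M (m≤m⊔n (fresh M) (fresh N)) (scoped-fresh M) , scoped-mono N (m≤n⊔m (fresh M) (fresh N)) (scoped-fresh N))
scoped-fresh (lam M) = scoped-mono M (n≤1+n (fresh M)) (scoped-fresh M)

fresh-not-free : ∀ M → ¬ FreeIn (fresh M) M
fresh-not-free M f = <-irrefl refl (scoped-free M (scoped-fresh M) f)

sub-fresh : ∀ N M → sub (fresh M) N M ≡ M
sub-fresh N M = sub-scoped N M (scoped-fresh M) ≤-refl

fpc-at : ∀ {Y} → FPC Y → ∀ M → app Y M =β app M (app Y M)
fpc-at {Y} fpc M with =β-sub {fresh Y} {M} (fpc (fresh Y) (fresh-not-free Y))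
... | e rewrite sub-fresh M Y | sub-var-≡ (fresh Y) M = e

⟨_⟩ : Term → Term
⟨ A ⟩ = lam (app (var 0) (shift 0 A))

I : Term
I = lam (var 0)

thrush : Term
thrush = lam (lam (app (var 0) (var 1)))

-- U = λuwx. x (u u ⟨w⟩ x)
U : Term
U = lam (lam (lam (app (var 0) (app (app (app (var 2) (var 2)) (lam (app (var 0) (var 2)))) (var 0)))))

UU : Term
UU = app U U

⟨⟩-apply : ∀ A N → app ⟨ A ⟩ N →* app N A
⟨⟩-apply A N = beta ◅ subst (app N (sub 0 N (shift 0 A)) →*_) (cong (app N) (sub-shift N A)) ε

thrush-apply : ∀ A → app thrush A →β ⟨ A ⟩
thrush-apply A = beta

UU-unfold : ∀ w X → app (app UU w) X →* app X (app (app UU ⟨ w ⟩) X)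
UU-unfold w X = appL (appL beta) ◅ appL beta ◅ beta ◅
  subst (λ w′ → app X (app (app UU (lam (app (var 0) w′))) X) →* app X (app (app UU ⟨ w ⟩) X))
        (sym (trans (cong (sub 1 (shift 0 X)) (sym (shift-shift w z≤n))) (sub-shift (shift 0 X) (shift 0 w)))) ε

UU-hnf : ∀ w → app UU w →* lam (app (var 0) (app (app UU ⟨ shift 0 w ⟩) (var 0)))
UU-hnf w = appL beta ◅ beta ◅ ε

UU-app-BTEq : ∀ k w w′ x → BTEq k (app (app UU w) (var x)) (app (app UU w′) (var x))
UU-app-BTEq zero w w′ x = bt-zero
UU-app-BTEq (suc k) w w′ x =
  bt-hnf 0 x 1 (_ ∷ []) (_ ∷ []) (→*⇒=β (UU-unfold w (var x))) (→*⇒=β (UU-unfold w′ (var x)))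
         λ { zero → UU-app-BTEq k ⟨ w ⟩ ⟨ w′ ⟩ x }

UU-=∞ : ∀ w w′ → app UU w =∞ app UU w′
UU-=∞ w w′ zero = bt-zero
UU-=∞ w w′ (suc k) =
  bt-hnf 1 0 1 (_ ∷ []) (_ ∷ []) (→*⇒=β (UU-hnf w)) (→*⇒=β (UU-hnf w′))
         λ { zero → UU-app-BTEq k ⟨ shift 0 w ⟩ ⟨ shift 0 w′ ⟩ 0 }

UU-wfpc : ∀ w → WFPC (app UU w)
UU-wfpc w x _ zero = bt-zero
UU-wfpc w x _ (suc k) =
  bt-hnf 0 x 1 (_ ∷ []) (_ ∷ []) (→*⇒=β (UU-unfold w (var x))) ε
         λ { zero → UU-app-BTEq k ⟨ w ⟩ w x }

hasHNF-resp-=β : ∀ {M N} → M =β N → HasHNF M → HasHNF N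
hasHNF-resp-=β e (n , i , m , Ps , h) = n , i , m , Ps , =β-sym e ◅◅ h

BTEq-respʳ-=β : ∀ {k M N N′} → N =β N′ → BTEq k M N → BTEq k M N′
BTEq-respʳ-=β e bt-zero = bt-zero
BTEq-respʳ-=β e (bt-uns uM uN) = bt-uns uM (uN ∘ hasHNF-resp-=β (=β-sym e))
BTEq-respʳ-=β e (bt-hnf n i m Ps Qs hM hN children) = bt-hnf n i m Ps Qs hM (=β-sym e ◅◅ hN) children

shift-⟨⟩ : ∀ c A → shift c ⟨ A ⟩ ≡ ⟨ shift c A ⟩
shift-⟨⟩ c A = cong (λ A′ → lam (app (var 0) A′)) (shift-shift A z≤n)

sub-⟨⟩ : ∀ j N A → sub j N ⟨ A ⟩ ≡ ⟨ sub j N A ⟩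
sub-⟨⟩ j N A = cong (λ A′ → lam (app (var 0) A′)) (sym (shift-sub-≤ N A z≤n))

=β-⟨⟩ : ∀ {A B} → A =β B → ⟨ A ⟩ =β ⟨ B ⟩
=β-⟨⟩ = =β-lam ∘ =β-appʳ ∘ =β-shift

data Inert : Term → Set where
  var : ∀ {i} → Inert (var i)
  thrush-inert : Inert thrush

inert-normal : ∀ {X} → Inert X → Normal X
inert-normal var = neutral var
inert-normal thrush-inert = lam (lam (neutral (app var (neutral var))))

inert-shift : ∀ {c X} → Inert X → Inert (shift c X)
inert-shift {c} (var {i}) with i <ᵇ c
... | true = var
... | false = var
inert-shift thrush-inert = thrush-inert

-- UUReduct X A C: C has one of the shapes a reduct of UU A X can have, with A known up to =β.
-- They trace one unfolding: UU A X itself, the redex after the first β-step, X (UU ⟨A⟩ X),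
-- and for X = thrush the head normal form λb. b (UU ⟨A⟩ thrush).
data UUHead : Term → Set
data UUReduct : Term → Term → Term → Set

data UUHead where
  root : UUHead UU
  unfolded : ∀ {C} → UUReduct (var 0) (var 1) C → UUHead (lam (lam C))

data UUReduct where
  head : ∀ {X A A′ s} → UUHead s → A =β A′ → UUReduct X A (app (app s A′) X)
  redex : ∀ {X A A′ D} → UUReduct (var 0) A′ D → A′ =β shift 0 A → UUReduct X A (app (lam D) X)
  unfold : ∀ {X A A′ C} → UUReduct X A′ C → A′ =β ⟨ A ⟩ → UUReduct X A (app X C)
  thrushed : ∀ {X A A′ D} → UUReduct (shift 0 X) A′ D → A′ =β shift 0 ⟨ A ⟩ → UUReduct X A (lam (app (var 0) D))

UUReduct-resp-=β : ∀ {X A B C} → A =β B → UUReduct X A C → UUReduct X B C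
UUReduct-resp-=β e (head s p) = head s (=β-sym e ◅◅ p)
UUReduct-resp-=β e (redex r p) = redex r (p ◅◅ =β-shift e)
UUReduct-resp-=β e (unfold r p) = unfold r (p ◅◅ =β-⟨⟩ e)
UUReduct-resp-=β e (thrushed r p) = thrushed r (p ◅◅ =β-shift (=β-⟨⟩ e))

UUHead-shift : ∀ {c s} → UUHead s → UUHead (shift c s)
UUReduct-shift : ∀ {c X A C} → UUReduct X A C → UUReduct (shift c X) (shift c A) (shift c C)
UUHead-shift root = root
UUHead-shift {c} (unfolded r) = unfolded (UUReduct-shift {suc (suc c)} r)
UUReduct-shift (head s p) = head (UUHead-shift s) (=β-shift p)
UUReduct-shift {c} {A = A} (redex r p) = redex (UUReduct-shift r) (=β-shift p ◅◅ ≡⇒=β (shift-shift A z≤n))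
UUReduct-shift {c} {A = A} (unfold r p) = unfold (UUReduct-shift r) (=β-shift p ◅◅ ≡⇒=β (shift-⟨⟩ c A))
UUReduct-shift {c} {X} {A} (thrushed r p) =
  thrushed (subst (λ X′ → UUReduct X′ _ _) (shift-shift X z≤n) (UUReduct-shift r))
           (=β-shift p ◅◅ ≡⇒=β (trans (shift-shift ⟨ A ⟩ z≤n) (cong (shift 0) (shift-⟨⟩ c A))))

UUHead-sub : ∀ {j N s} → UUHead s → UUHead (sub j N s)
UUReduct-sub : ∀ {j N X A C} → UUReduct X A C → UUReduct (sub j N X) (sub j N A) (sub j N C)
UUHead-sub root = root
UUHead-sub {j} (unfolded r) = unfolded (UUReduct-sub {suc (suc j)} r)
UUReduct-sub (head s p) = head (UUHead-sub s) (=β-sub p)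
UUReduct-sub {j} {N} {A = A} (redex r p) = redex (UUReduct-sub r) (=β-sub p ◅◅ ≡⇒=β (sym (shift-sub-≤ N A z≤n)))
UUReduct-sub {j} {N} {A = A} (unfold r p) = unfold (UUReduct-sub r) (=β-sub p ◅◅ ≡⇒=β (sub-⟨⟩ j N A))
UUReduct-sub {j} {N} {X} {A} (thrushed r p) =
  thrushed (subst (λ X′ → UUReduct X′ _ _) (sym (shift-sub-≤ N X z≤n)) (UUReduct-sub r))
           (=β-sub p ◅◅ ≡⇒=β (trans (sym (shift-sub-≤ N ⟨ A ⟩ z≤n)) (cong (shift 0) (sub-⟨⟩ j N A))))

U-normal : Normal U
U-normal = lam (lam (lam (neutral (app var (neutral (app (app (app var (neutral var)) (lam (neutral (app var (neutral var))))) (neutral var)))))))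

UUHead-step : ∀ {s s′} → UUHead s → s →β s′ → UUHead s′
UUReduct-step : ∀ {X A C C′} → Inert X → UUReduct X A C → C →β C′ → UUReduct X A C′
UUHead-step root beta = unfolded (unfold (head root ε) ε)
UUHead-step root (appL s) = contradiction s (normal-irreducible U-normal)
UUHead-step root (appR s) = contradiction s (normal-irreducible U-normal)
UUHead-step (unfolded r) (ξ (ξ s)) = unfolded (UUReduct-step var r s)
UUReduct-step _ (head (unfolded r) p) (appL beta) = redex (UUReduct-sub r) (=β-shift (=β-sym p))
UUReduct-step _ (head s p) (appL (appL st)) = head (UUHead-step s st) p
UUReduct-step _ (head s p) (appL (appR st)) = head s (p ◅◅ EqClosure.return st)
UUReduct-step x (head s p) (appR st) = contradiction st (normal-irreducible (inert-normal x))
UUReduct-step {X} _ (redex r p) beta =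
  UUReduct-resp-=β (=β-sub p ◅◅ ≡⇒=β (sub-shift X _)) (UUReduct-sub r)
UUReduct-step _ (redex r p) (appL (ξ st)) = redex (UUReduct-step var r st) p
UUReduct-step x (redex r p) (appR st) = contradiction st (normal-irreducible (inert-normal x))
UUReduct-step thrush-inert (unfold r p) beta = thrushed (UUReduct-shift r) (=β-shift p)
UUReduct-step x (unfold r p) (appL st) = contradiction st (normal-irreducible (inert-normal x))
UUReduct-step x (unfold r p) (appR st) = unfold (UUReduct-step x r st) p
UUReduct-step x (thrushed r p) (ξ (appR st)) = thrushed (UUReduct-step (inert-shift x) r st) p

UUReduct-→* : ∀ {X A C C′} → Inert X → UUReduct X A C → C →* C′ → UUReduct X A C′
UUReduct-→* _ r ε = r
UUReduct-→* x r (s ◅ ss) = UUReduct-→* x (UUReduct-step x r s) ss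

var-app-→* : ∀ {i E C} → app (var i) E →* C → ∃[ E′ ] (C ≡ app (var i) E′ × E →* E′)
var-app-→* ε = _ , refl , ε
var-app-→* (appR s ◅ ss) with var-app-→* ss
... | E′ , refl , r = E′ , refl , s ◅ r

var-app-injective : ∀ {i E F} → app (var i) E =β app (var i) F → E =β F
var-app-injective e with church-rosser e
... | _ , a , b with var-app-→* a | var-app-→* b
... | _ , refl , ra | _ , refl , rb = →*⇒=β ra ◅◅ =β-sym (→*⇒=β rb)

lam-→* : ∀ {M C} → lam M →* C → ∃[ M′ ] (C ≡ lam M′ × M →* M′)
lam-→* ε = _ , refl , ε
lam-→* (ξ s ◅ ss) with lam-→* ss
... | M′ , refl , r = M′ , refl , s ◅ r

lam-injective : ∀ {M N} → lam M =β lam N → M =β N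
lam-injective e with church-rosser e
... | _ , a , b with lam-→* a | lam-→* b
... | _ , refl , ra | _ , refl , rb = →*⇒=β ra ◅◅ =β-sym (→*⇒=β rb)

⟨⟩-injective : ∀ {A B} → ⟨ A ⟩ =β ⟨ B ⟩ → A =β B
⟨⟩-injective = =β-unshift ∘ var-app-injective ∘ lam-injective

UUReduct-unique : ∀ {X A B C} → Inert X → UUReduct X A C → UUReduct X B C → A =β B
UUReduct-unique _ (head _ p) (head _ q) = p ◅◅ =β-sym q
UUReduct-unique _ (redex r p) (redex r′ q) = =β-unshift (=β-sym p ◅◅ UUReduct-unique var r r′ ◅◅ q)
UUReduct-unique x (unfold r p) (unfold r′ q) = ⟨⟩-injective (=β-sym p ◅◅ UUReduct-unique x r r′ ◅◅ q)
UUReduct-unique x (thrushed r p) (thrushed r′ q) =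
  ⟨⟩-injective (=β-unshift (=β-sym p ◅◅ UUReduct-unique (inert-shift x) r r′ ◅◅ q))
UUReduct-unique thrush-inert (redex _ _) (unfold () _)
UUReduct-unique thrush-inert (unfold () _) (redex _ _)

UU-injective : ∀ {X A B} → Inert X → app (app UU A) X =β app (app UU B) X → A =β B
UU-injective x e with church-rosser e
... | _ , a , b = UUReduct-unique x (UUReduct-→* x (head root ε) a) (UUReduct-→* x (head root ε) b)

G : Term × List Term
G = thrush , UU ∷ []

thrush-UU-fgv : FGV G
thrush-UU-fgv Y fpc x _ = begin
  app (app y UU) (var x)                   ≈⟨ =β-appˡ y-UU ⟩
  app (app UU y) (var x)                   ≈⟨ →*⇒=β (UU-unfold y (var x)) ⟩
  app (var x) (app (app UU ⟨ y ⟩) (var x)) ≈⟨ =β-appʳ (=β-appˡ (=β-appʳ y=⟨y⟩)) ⟨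
  app (var x) (app (app UU y) (var x))     ≈⟨ =β-appʳ (=β-appˡ y-UU) ⟨
  app (var x) (app (app y UU) (var x))     ∎
  where
  open =β-Reasoning
  y = app Y thrush
  y=⟨y⟩ : y =β ⟨ y ⟩
  y=⟨y⟩ = fpc-at fpc thrush ◅◅ EqClosure.return (thrush-apply y)
  y-UU : app y UU =β app UU y
  y-UU = =β-appˡ y=⟨y⟩ ◅◅ →*⇒=β (⟨⟩-apply y UU)

thrush-UU-weaklyConstant : WeaklyConstant G
thrush-UU-weaklyConstant z _ =
  1 , app UU I , BTEq-respʳ-=β thrush-z-UU ∘ UU-=∞ I (var z) , closed-not-free (app UU I) tt
  where
  thrush-z-UU : app UU (var z) =β app (app thrush (var z)) UU
  thrush-z-UU = =β-sym (EqClosure.return (appL (thrush-apply (var z))) ◅◅ →*⇒=β (⟨⟩-apply (var z) UU))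

thrush-UU-¬rectifying : ¬ Rectifying G
thrush-UU-¬rectifying rect = I≢⟨I⟩ (normal-=β-≡ (lam (neutral var)) (lam (neutral (app var (lam (neutral var))))) I=⟨I⟩)
  where
  open =β-Reasoning
  Y₀ = app UU I
  P : Term → Term
  P A = app (app UU ⟨ A ⟩) thrush
  UU-thrush : ∀ A → app (app UU A) thrush →* ⟨ P A ⟩
  UU-thrush A = UU-unfold A thrush ◅◅ thrush-apply (P A) ◅ ε
  Y₀G=UUPI : app (app Y₀ thrush) UU =β app UU (P I)
  Y₀G=UUPI = →*⇒=β (→*-appˡ (UU-thrush I) ◅◅ ⟨⟩-apply (P I) UU)
  ⟨PI⟩=PI : ⟨ P I ⟩ =β P I
  ⟨PI⟩=PI = UU-injective var (var-app-injective (begin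
    app (var 0) (app (app UU ⟨ P I ⟩) (var 0))          ≈⟨ →*⇒=β (UU-unfold (P I) (var 0)) ⟨
    app (app UU (P I)) (var 0)                          ≈⟨ =β-appˡ Y₀G=UUPI ⟨
    app (app (app Y₀ thrush) UU) (var 0)                ≈⟨ rect Y₀ (UU-wfpc I) 0 (closed-not-free (app (app Y₀ thrush) UU) tt) ⟩
    app (var 0) (app (app (app Y₀ thrush) UU) (var 0))  ≈⟨ =β-appʳ (=β-appˡ Y₀G=UUPI) ⟩
    app (var 0) (app (app UU (P I)) (var 0))            ∎))
  I=⟨I⟩ : I =β ⟨ I ⟩
  I=⟨I⟩ = ⟨⟩-injective (UU-injective thrush-inert (⟨⟩-injective (⟨PI⟩=PI ◅◅ →*⇒=β (UU-thrush ⟨ I ⟩))))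
  I≢⟨I⟩ : I ≢ ⟨ I ⟩
  I≢⟨I⟩ ()

proposition5p6 : Σ (Term × List Term) (λ G → FGV G × WeaklyConstant G × ¬ Rectifying G)
proposition5p6 = G , thrush-UU-fgv , thrush-UU-weaklyConstant , thrush-UU-¬rectifying
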